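{- Let $\mathbf{A}\in\{0,1\}^{d\times n}$, $k\ge1$, and let $(\mathbf{U},\mathbf{V})$ be an optimal solution of $\min_{\mathbf{U}\in\{0,1\}^{d\times k},\mathbf{V}\in\{0,1\}^{k\times n}}\|\mathbf{A}-\mathbf{U}\mathbf{V}\|_F^2$ over the Boolean semiring, with optimal value $\mathrm{OPT}_k$. Let $\mathcal{S}_1,\dots,\mathcal{S}_{2^k-1}$ be an enumeration of the nonempty subsets of $[k]$ with $n_{\mathcal{S}_1}\le n_{\mathcal{S}_2}\le\dots\le n_{\mathcal{S}_{2^k-1}}$. Suppose $\mathcal{B}_1,\dots,\mathcal{B}_k\subseteq[d]$ satisfy, for all $\ell\in[2^k-1]$, \[ \mathcal{U}_{\mathcal{S}_\ell}\triangle\Big(\bigcup_{i\in\mathcal{S}_\ell}\mathcal{B}_i\Big)\subseteq\bigcup_{\ell'\ge\ell}\big(\mathcal{U}_{\mathcal{S}_{\ell'}}\triangle\mathcal{D}_{\mathcal{S}_{\ell'}}\big). \] Then $\mathrm{Err}(\mathcal{B}_1,\dots,\mathcal{B}_k)\le 2^k\,\mathrm{OPT}_k$.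
   Context: Boolean product: $(\mathbf{U}\mathbf{V})_{ij}=\bigvee_l(u_{il}\wedge v_{lj})$; $\|\mathbf{M}\|_F^2$ counts the $1$ entries of a binary matrix. Binary vectors are identified with subsets: $\mathcal{A}_j\subseteq[d]$ is the $j$th column of $\mathbf{A}$, $\mathcal{U}_i\subseteq[d]$ the $i$th column of $\mathbf{U}$, and $\mathcal{V}_j\subseteq[k]$ the $j$th column of $\mathbf{V}$. For $\mathcal{S}\subseteq[k]$: $\mathcal{U}_{\mathcal{S}}:=\bigcup_{i\in\mathcal{S}}\mathcal{U}_i$, $\mathcal{J}_{\mathcal{S}}:=\{j\in[n]:\mathcal{V}_j=\mathcal{S}\}$, $n_{\mathcal{S}}:=|\mathcal{J}_{\mathcal{S}}|$, and $\mathcal{D}_{\mathcal{S}}$ is a column $\mathcal{A}_j$ of $\mathbf{A}$ minimizing $|\mathcal{A}_j\triangle\mathcal{U}_{\mathcal{S}}|$ (nearest neighbor, ties broken arbitrarily). $\mathrm{Err}(\mathcal{B}_1,\dots,\mathcal{B}_k):=\sum_{j=1}^n\min_{T\subseteq[k]}|\mathcal{A}_j\triangle\bigcup_{i\in T}\mathcal{B}_i|$. -}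

module Defs where

open import Data.Nat using (ℕ; zero; suc; _+_; _⊓_)
open import Data.Bool using (Bool; true; false)
open import Data.Fin using (Fin; zero; suc)
open import Data.Vec using (Vec; []; _∷_; head; tail)
open import Data.Fin.Subset using (Subset; _∪_; _─_; ⊥; ∣_∣; inside; outside)
open import Data.Fin.Subset.Properties using ()
open import Data.Vec.Properties using (≡-dec)
import Data.Bool.Properties as BP
open import Relation.Nullary using (yes; no)

_△_ : ∀ {d} → Subset d → Subset d → Subset d
X △ Y = (X ─ Y) ∪ (Y ─ X)

-- U_S := ⋃_{i ∈ S} U_i, for a family U : [k] → 2^[d] (columns of U).
-- Equivalently the j-th column of the Boolean product U V when S = V_j.
⋃[_]_ : ∀ {k d} → (Fin k → Subset d) → Subset k → Subset d
⋃[_]_ {zero}  U S = ⊥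
⋃[_]_ {suc k} U (true  ∷ S) = U zero ∪ (⋃[ (λ i → U (suc i)) ] S)
⋃[_]_ {suc k} U (false ∷ S) = ⋃[ (λ i → U (suc i)) ] S

sumFin : ∀ {n} → (Fin n → ℕ) → ℕ
sumFin {zero}  f = 0
sumFin {suc n} f = f zero + sumFin (λ j → f (suc j))

minSubset : ∀ {k} → (Subset k → ℕ) → ℕ
minSubset {zero}  f = f []
minSubset {suc k} f = minSubset (λ T → f (false ∷ T)) ⊓ minSubset (λ T → f (true ∷ T))

-- ‖A − U V‖_F² over the Boolean semiring, with A given by its columns
-- A : [n] → 2^[d], U by its columns U : [k] → 2^[d], V by its columns V : [n] → 2^[k].
cost : ∀ {d k n} → (Fin n → Subset d) → (Fin k → Subset d) → (Fin n → Subset k) → ℕ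
cost A U V = sumFin (λ j → ∣ A j △ (⋃[ U ] V j) ∣)

Err : ∀ {d k n} → (Fin n → Subset d) → (Fin k → Subset d) → ℕ
Err A B = sumFin (λ j → minSubset (λ T → ∣ A j △ (⋃[ B ] T) ∣))

nCount : ∀ {k n} → (Fin n → Subset k) → Subset k → ℕ
nCount V S = sumFin (λ j → indicator (≡-dec BP._≟_ (V j) S))
  where
  indicator : ∀ {P : Set} → Relation.Nullary.Dec P → ℕ
  indicator (yes _) = 1
  indicator (no  _) = 0

module Submission where

-- Write f_j = |A_j △ U_{V_j}|, e_ℓ = |U_{S_ℓ} △ D_{S_ℓ}|, c_ℓ = n_{S_ℓ} and
-- g_ℓ = Σ_{ℓ' ≥ ℓ} e_ℓ'.  The proof has four ingredients:
--  * column bound: representing column j with the index set V_j gives, by the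
--    triangle inequality for |_△_| and the union bound for the covering
--    hypothesis, a cost of at most f_j + g_ℓ when V_j = S_ℓ (and f_j if V_j = ∅);
--  * regrouping by classes: Σ_j g_{ℓ(j)} = Σ_ℓ c_ℓ g_ℓ;
--  * monotone rearrangement: since c is monotone, Σ_ℓ c_ℓ g_ℓ ≤ M Σ_ℓ c_ℓ e_ℓ;
--  * nearest neighbours: c_ℓ e_ℓ ≤ Σ_{j ∈ J_{S_ℓ}} f_j, and the classes J_{S_ℓ}
--    are disjoint, so Σ_ℓ c_ℓ e_ℓ ≤ Σ_j f_j.
-- Altogether Err ≤ (1 + M) Σ_j f_j = 2^k · cost A U V.

open import Defs
open import Data.Nat using (ℕ; _≤_; _*_; _^_; _∸_)
open import Data.Fin using (Fin)
import Data.Fin as F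
open import Data.Fin.Subset using (Subset; _∈_; _⊆_; Nonempty; ∣_∣)
open import Data.Product using (Σ; ∃; _×_)
open import Function.Definitions using (Injective)
open import Relation.Binary.PropositionalEquality using (_≡_)

open import Data.Nat using (zero; suc; _+_; z≤n; s≤s)
open import Data.Nat.Properties
open import Data.Bool using (true; false)
import Data.Bool.Properties as BP
open import Data.Fin using (zero; suc)
import Data.Fin.Properties as FP
open import Data.Vec using ([]; _∷_)
open import Data.Vec.Properties using (≡-dec)
open import Data.Fin.Subset using (_∪_; _─_; ⊥; ⊤)
open import Data.Fin.Subset.Properties using (nonempty?; Empty-unique; ∣⊥∣≡0; p⊆p∪q; q⊆p∪q; p⊆q⇒∣p∣≤∣q∣; ∪-comm)
open import Data.Product using (_,_)
open import Function using (_∘_)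
open import Relation.Nullary using (Dec; yes; no; contradiction)
open import Relation.Unary using (Decidable)
open import Relation.Binary.Definitions using (DecidableEquality)
open import Relation.Binary.PropositionalEquality using (refl; sym; trans; cong; cong₂)
open import Algebra.Properties.Semiring.Sum +-*-semiring
  using (sum; sum-syntax; sum-cong-≗; sum-remove; sum-replicate-zero; ∑-distrib-+; ∑-comm; *-distribˡ-sum; *-distribʳ-sum)

sumFin≡sum : ∀ {n} (f : Fin n → ℕ) → sumFin f ≡ sum f
sumFin≡sum {zero}  f = refl
sumFin≡sum {suc n} f = cong (f zero +_) (sumFin≡sum (f ∘ suc))

sum-mono-≤ : ∀ {n} {f g : Fin n → ℕ} → (∀ i → f i ≤ g i) → sum f ≤ sum g
sum-mono-≤ {zero}  f≤g = z≤n
sum-mono-≤ {suc n} f≤g = +-mono-≤ (f≤g zero) (sum-mono-≤ (f≤g ∘ suc))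

term≤sum : ∀ {n} (f : Fin n → ℕ) (i : Fin n) → f i ≤ sum f
term≤sum {suc n} f i = ≤-trans (m≤m+n (f i) _) (≤-reflexive (sym (sum-remove {i = i} f)))

sum-const : ∀ n (x : ℕ) → ∑[ i < n ] x ≡ n * x
sum-const zero    x = refl
sum-const (suc n) x = cong (x +_) (sum-const n x)

𝟙 : ∀ {P : Set} → Dec P → ℕ
𝟙 (yes _) = 1
𝟙 (no _)  = 0

indicator-injective : ∀ {m} {X : Set} (_≟_ : DecidableEquality X) {S : Fin m → X} →
  Injective _≡_ _≡_ S → ∀ v → ∑[ ℓ < m ] 𝟙 (v ≟ S ℓ) ≤ 1
indicator-injective {zero}  _≟_ inj v = z≤n
indicator-injective {suc m} _≟_ {S} inj v with v ≟ S zero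
... | yes v≡S₀ = s≤s (≤-reflexive (trans (sum-cong-≗ elsewhere-0) (sum-replicate-zero m)))
  where
  elsewhere-0 : ∀ ℓ → 𝟙 (v ≟ S (suc ℓ)) ≡ 0
  elsewhere-0 ℓ with v ≟ S (suc ℓ)
  ... | yes v≡Sℓ = contradiction (inj (trans (sym v≡S₀) v≡Sℓ)) FP.0≢1+n
  ... | no _     = refl
... | no _ = indicator-injective _≟_ (FP.suc-injective ∘ inj) v

∣∪∣≤∣∣+∣∣ : ∀ {d} (p q : Subset d) → ∣ p ∪ q ∣ ≤ ∣ p ∣ + ∣ q ∣
∣∪∣≤∣∣+∣∣ []          []          = z≤n
∣∪∣≤∣∣+∣∣ (true ∷ p)  (true ∷ q)  = s≤s (≤-trans (∣∪∣≤∣∣+∣∣ p q) (+-monoʳ-≤ ∣ p ∣ (n≤1+n ∣ q ∣)))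
∣∪∣≤∣∣+∣∣ (true ∷ p)  (false ∷ q) = s≤s (∣∪∣≤∣∣+∣∣ p q)
∣∪∣≤∣∣+∣∣ (false ∷ p) (true ∷ q)  = ≤-trans (s≤s (∣∪∣≤∣∣+∣∣ p q)) (≤-reflexive (sym (+-suc ∣ p ∣ ∣ q ∣)))
∣∪∣≤∣∣+∣∣ (false ∷ p) (false ∷ q) = ∣∪∣≤∣∣+∣∣ p q

△-sym : ∀ {d} (X Y : Subset d) → ∣ X △ Y ∣ ≡ ∣ Y △ X ∣
△-sym X Y = cong ∣_∣ (∪-comm (X ─ Y) (Y ─ X))

△-self : ∀ {d} (X : Subset d) → ∣ X △ X ∣ ≡ 0
△-self []          = refl
△-self (true ∷ X)  = △-self X
△-self (false ∷ X) = △-self X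

-- Arithmetic of one coordinate in the triangle inequality: the coordinate
-- counts on the left and in the second term, or in both terms on the right.
differ-right : ∀ {a b c} → a ≤ b + c → suc a ≤ b + suc c
differ-right {a} {b} {c} a≤b+c = ≤-trans (s≤s a≤b+c) (≤-reflexive (sym (+-suc b c)))

differ-both : ∀ {a b c} → a ≤ b + c → a ≤ suc b + suc c
differ-both {a} {b} {c} a≤b+c = ≤-trans a≤b+c (+-mono-≤ (n≤1+n b) (n≤1+n c))

△-triangle : ∀ {d} (X Y Z : Subset d) → ∣ X △ Z ∣ ≤ ∣ X △ Y ∣ + ∣ Y △ Z ∣
△-triangle []          []          []          = z≤n
△-triangle (true ∷ X)  (true ∷ Y)  (true ∷ Z)  = △-triangle X Y Z
△-triangle (true ∷ X)  (true ∷ Y)  (false ∷ Z) = differ-right (△-triangle X Y Z)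
△-triangle (true ∷ X)  (false ∷ Y) (true ∷ Z)  = differ-both (△-triangle X Y Z)
△-triangle (true ∷ X)  (false ∷ Y) (false ∷ Z) = s≤s (△-triangle X Y Z)
△-triangle (false ∷ X) (true ∷ Y)  (true ∷ Z)  = s≤s (△-triangle X Y Z)
△-triangle (false ∷ X) (true ∷ Y)  (false ∷ Z) = differ-both (△-triangle X Y Z)
△-triangle (false ∷ X) (false ∷ Y) (true ∷ Z)  = differ-right (△-triangle X Y Z)
△-triangle (false ∷ X) (false ∷ Y) (false ∷ Z) = △-triangle X Y Z

∈-⋃⊤ : ∀ {m d} (E : Fin m → Subset d) (i : Fin m) {x : Fin d} → x ∈ E i → x ∈ ⋃[ E ] ⊤
∈-⋃⊤ E zero    x∈Ei = p⊆p∪q _ x∈Ei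
∈-⋃⊤ E (suc i) x∈Ei = q⊆p∪q (E zero) _ (∈-⋃⊤ (E ∘ suc) i x∈Ei)

∣⋃⊤∣≤∑ : ∀ {m d} (E : Fin m → Subset d) → ∣ ⋃[ E ] ⊤ ∣ ≤ ∑[ i < m ] ∣ E i ∣
∣⋃⊤∣≤∑ {zero}  {d} E = ≤-reflexive (∣⊥∣≡0 d)
∣⋃⊤∣≤∑ {suc m}     E = ≤-trans (∣∪∣≤∣∣+∣∣ (E zero) _) (+-monoʳ-≤ ∣ E zero ∣ (∣⋃⊤∣≤∑ (E ∘ suc)))

only : ∀ {d} {P : Set} → Dec P → Subset d → Subset d
only (yes _) X = X
only (no _)  X = ⊥

∣only∣ : ∀ {d} {P : Set} (p? : Dec P) (X : Subset d) → ∣ only p? X ∣ ≡ 𝟙 p? * ∣ X ∣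
∣only∣         (yes _) X = sym (*-identityˡ ∣ X ∣)
∣only∣ {d = d} (no _)  X = ∣⊥∣≡0 d

∈-only : ∀ {d} {P : Set} (p? : Dec P) {X : Subset d} {x : Fin d} → P → x ∈ X → x ∈ only p? X
∈-only (yes _) p x∈X = x∈X
∈-only (no ¬p) p x∈X = contradiction p ¬p

union-bound : ∀ {m d} {Q : Fin m → Set} (Q? : Decidable Q) (E : Fin m → Subset d) (P : Subset d) →
  (∀ x → x ∈ P → ∃ λ i → Q i × x ∈ E i) → ∣ P ∣ ≤ ∑[ i < m ] (𝟙 (Q? i) * ∣ E i ∣)
union-bound {m} Q? E P covered = begin
  ∣ P ∣                              ≤⟨ p⊆q⇒∣p∣≤∣q∣ P⊆⋃ ⟩
  ∣ ⋃[ E′ ] ⊤ ∣                      ≤⟨ ∣⋃⊤∣≤∑ E′ ⟩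
  ∑[ i < m ] ∣ E′ i ∣                ≡⟨ sum-cong-≗ (λ i → ∣only∣ (Q? i) (E i)) ⟩
  ∑[ i < m ] (𝟙 (Q? i) * ∣ E i ∣)    ∎
  where
  open ≤-Reasoning
  E′ : Fin m → Subset _
  E′ i = only (Q? i) (E i)
  P⊆⋃ : P ⊆ ⋃[ E′ ] ⊤
  P⊆⋃ {x} x∈P with covered x x∈P
  ... | i , Qi , x∈Ei = ∈-⋃⊤ E′ i (∈-only (Q? i) Qi x∈Ei)

minSubset≤ : ∀ {k} (f : Subset k → ℕ) (T : Subset k) → minSubset f ≤ f T
minSubset≤ {zero}  f []          = ≤-refl
minSubset≤ {suc k} f (false ∷ T) = ≤-trans (m⊓n≤m _ _) (minSubset≤ (λ T′ → f (false ∷ T′)) T)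
minSubset≤ {suc k} f (true ∷ T)  = ≤-trans (m⊓n≤n _ _) (minSubset≤ (λ T′ → f (true ∷ T′)) T)

⋃-⊥ : ∀ {k d} (E : Fin k → Subset d) → ⋃[ E ] ⊥ ≡ ⊥
⋃-⊥ {zero}  E = refl
⋃-⊥ {suc k} E = ⋃-⊥ (E ∘ suc)

⋃-⊥-agree : ∀ {k d} (U B : Fin k → Subset d) → ∣ (⋃[ U ] ⊥) △ (⋃[ B ] ⊥) ∣ ≡ 0
⋃-⊥-agree {d = d} U B = trans (cong₂ (λ X Y → ∣ X △ Y ∣) (⋃-⊥ U) (⋃-⊥ B)) (△-self (⊥ {d}))

column-bound : ∀ {k d} (a : Subset d) (U B : Fin k → Subset d) (T : Subset k) →
  minSubset (λ T′ → ∣ a △ (⋃[ B ] T′) ∣) ≤ ∣ a △ (⋃[ U ] T) ∣ + ∣ (⋃[ U ] T) △ (⋃[ B ] T) ∣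
column-bound a U B T = ≤-trans (minSubset≤ (λ T′ → ∣ a △ (⋃[ B ] T′) ∣) T) (△-triangle a (⋃[ U ] T) (⋃[ B ] T))

_≟ˢ_ : ∀ {k} → DecidableEquality (Subset k)
_≟ˢ_ = ≡-dec BP._≟_

nCount≡∑ : ∀ {k n} (V : Fin n → Subset k) (T : Subset k) → nCount V T ≡ ∑[ j < n ] 𝟙 (V j ≟ˢ T)
nCount≡∑ {n = zero}  V T = refl
nCount≡∑ {n = suc n} V T with V zero ≟ˢ T
... | yes _ = cong suc (nCount≡∑ (V ∘ suc) T)
... | no _  = nCount≡∑ (V ∘ suc) T

count-weighted : ∀ {k n} (V : Fin n → Subset k) (T : Subset k) (x : ℕ) →
  ∑[ j < n ] (𝟙 (V j ≟ˢ T) * x) ≡ nCount V T * x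
count-weighted V T x = trans (sym (*-distribʳ-sum x (λ j → 𝟙 (V j ≟ˢ T)))) (cong (_* x) (sym (nCount≡∑ V T)))

class-term : ∀ {k m} (S : Fin m → Subset k) → (∀ T → Nonempty T → ∃ λ ℓ → S ℓ ≡ T) →
  (h : Subset k → ℕ) → h ⊥ ≡ 0 → (g : Fin m → ℕ) → (∀ ℓ → h (S ℓ) ≤ g ℓ) →
  ∀ T → h T ≤ ∑[ ℓ < m ] (𝟙 (T ≟ˢ S ℓ) * g ℓ)
class-term S onto h h⊥ g h≤g T with nonempty? T
... | no T-empty rewrite Empty-unique T-empty | h⊥ = z≤n
... | yes T-nonempty with onto T T-nonempty
... | ℓ , refl = ≤-trans (h≤g ℓ) (≤-trans own-term (term≤sum _ ℓ))
  where
  own-term : g ℓ ≤ 𝟙 (S ℓ ≟ˢ S ℓ) * g ℓ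
  own-term with S ℓ ≟ˢ S ℓ
  ... | yes _   = ≤-reflexive (sym (*-identityˡ (g ℓ)))
  ... | no S≢S = contradiction refl S≢S

-- Monotone rearrangement: if c is nondecreasing then
-- Σ_ℓ c_ℓ · Σ_{ℓ' ≥ ℓ} e_ℓ' ≤ m · Σ_ℓ' c_ℓ' e_ℓ', by raising each c_ℓ to c_ℓ'.
tail-bound : ∀ {m} (c e : Fin m → ℕ) → (∀ ℓ ℓ′ → ℓ F.≤ ℓ′ → c ℓ ≤ c ℓ′) →
  ∑[ ℓ < m ] (c ℓ * ∑[ ℓ′ < m ] (𝟙 (ℓ FP.≤? ℓ′) * e ℓ′)) ≤ m * ∑[ ℓ′ < m ] (c ℓ′ * e ℓ′)
tail-bound {m} c e mono = begin
  ∑[ ℓ < m ] (c ℓ * ∑[ ℓ′ < m ] (𝟙 (ℓ FP.≤? ℓ′) * e ℓ′))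
    ≡⟨ sum-cong-≗ (λ ℓ → *-distribˡ-sum (c ℓ) (λ ℓ′ → 𝟙 (ℓ FP.≤? ℓ′) * e ℓ′)) ⟩
  ∑[ ℓ < m ] ∑[ ℓ′ < m ] (c ℓ * (𝟙 (ℓ FP.≤? ℓ′) * e ℓ′))
    ≤⟨ sum-mono-≤ (λ ℓ → sum-mono-≤ (raise ℓ)) ⟩
  ∑[ ℓ < m ] ∑[ ℓ′ < m ] (c ℓ′ * e ℓ′)
    ≡⟨ sum-const m _ ⟩
  m * ∑[ ℓ′ < m ] (c ℓ′ * e ℓ′) ∎
  where
  open ≤-Reasoning
  raise : ∀ ℓ ℓ′ → c ℓ * (𝟙 (ℓ FP.≤? ℓ′) * e ℓ′) ≤ c ℓ′ * e ℓ′
  raise ℓ ℓ′ with ℓ FP.≤? ℓ′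
  ... | yes ℓ≤ℓ′ = *-mono-≤ (mono ℓ ℓ′ ℓ≤ℓ′) (≤-reflexive (*-identityˡ (e ℓ′)))
  ... | no _     = ≤-trans (≤-reflexive (*-zeroʳ (c ℓ))) z≤n

-- The classes J_{S ℓ} of an injective enumeration S are pairwise disjoint, so
-- summing f over every class counts each column at most once.
classes-disjoint : ∀ {k m n} (V : Fin n → Subset k) {S : Fin m → Subset k} → Injective _≡_ _≡_ S →
  (f : Fin n → ℕ) → ∑[ ℓ < m ] ∑[ j < n ] (𝟙 (V j ≟ˢ S ℓ) * f j) ≤ ∑[ j < n ] f j
classes-disjoint {m = m} {n} V {S} inj f = begin
  ∑[ ℓ < m ] ∑[ j < n ] (𝟙 (V j ≟ˢ S ℓ) * f j)
    ≡⟨ ∑-comm (λ ℓ j → 𝟙 (V j ≟ˢ S ℓ) * f j) ⟩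
  ∑[ j < n ] ∑[ ℓ < m ] (𝟙 (V j ≟ˢ S ℓ) * f j)
    ≡⟨ sum-cong-≗ (λ j → sym (*-distribʳ-sum (f j) (λ ℓ → 𝟙 (V j ≟ˢ S ℓ)))) ⟩
  ∑[ j < n ] (∑[ ℓ < m ] 𝟙 (V j ≟ˢ S ℓ) * f j)
    ≤⟨ sum-mono-≤ (λ j → *-monoˡ-≤ (f j) (indicator-injective _≟ˢ_ inj (V j))) ⟩
  ∑[ j < n ] (1 * f j)
    ≡⟨ sum-cong-≗ (λ j → *-identityˡ (f j)) ⟩
  ∑[ j < n ] f j ∎
  where open ≤-Reasoning

-- Nearest neighbour: if the column A c is closest to U_T, every column of the
-- class J_T is at least as far from U_T, so n_T · |U_T △ A c| ≤ Σ_{j ∈ J_T} f_j.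
class-cost : ∀ {d k n} (A : Fin n → Subset d) (U : Fin k → Subset d) (V : Fin n → Subset k)
  (T : Subset k) (c : Fin n) → (∀ j → ∣ A c △ (⋃[ U ] T) ∣ ≤ ∣ A j △ (⋃[ U ] T) ∣) →
  nCount V T * ∣ (⋃[ U ] T) △ A c ∣ ≤ ∑[ j < n ] (𝟙 (V j ≟ˢ T) * ∣ A j △ (⋃[ U ] V j) ∣)
class-cost A U V T c nearest =
  ≤-trans (≤-reflexive (sym (count-weighted V T ∣ (⋃[ U ] T) △ A c ∣))) (sum-mono-≤ member-cost)
  where
  member-cost : ∀ j → 𝟙 (V j ≟ˢ T) * ∣ (⋃[ U ] T) △ A c ∣ ≤ 𝟙 (V j ≟ˢ T) * ∣ A j △ (⋃[ U ] V j) ∣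
  member-cost j with V j ≟ˢ T
  ... | yes Vj≡T rewrite Vj≡T = *-monoʳ-≤ 1 (≤-trans (≤-reflexive (△-sym (⋃[ U ] T) (A c))) (nearest j))
  ... | no _ = z≤n

lemma3 : ∀ {d n k : ℕ} → 1 ≤ k
    → (A : Fin n → Subset d)
    → (U : Fin k → Subset d) (V : Fin n → Subset k)
    → (∀ (U' : Fin k → Subset d) (V' : Fin n → Subset k) → cost A U V ≤ cost A U' V')
    → (S : Fin (2 ^ k ∸ 1) → Subset k)
    → Injective _≡_ _≡_ S
    → (∀ ℓ → Nonempty (S ℓ))
    → (∀ (T : Subset k) → Nonempty T → ∃ λ ℓ → S ℓ ≡ T)
    → (∀ ℓ ℓ' → ℓ F.≤ ℓ' → nCount V (S ℓ) ≤ nCount V (S ℓ'))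
    → (D : Subset k → Fin n)
    → (∀ (T : Subset k) (j : Fin n) → ∣ A (D T) △ (⋃[ U ] T) ∣ ≤ ∣ A j △ (⋃[ U ] T) ∣)
    → (B : Fin k → Subset d)
    → (∀ ℓ (x : Fin d) → x ∈ ((⋃[ U ] S ℓ) △ (⋃[ B ] S ℓ))
         → ∃ λ ℓ' → ℓ F.≤ ℓ' × x ∈ ((⋃[ U ] S ℓ') △ A (D (S ℓ'))))
    → Err A B ≤ 2 ^ k * cost A U V
lemma3 {n = n} {k = k} _ A U V _ S inj _ onto mono D nearest B cover = begin
  Err A B                                              ≡⟨ sumFin≡sum err ⟩
  ∑[ j < n ] err j                                     ≤⟨ sum-mono-≤ column ⟩
  ∑[ j < n ] (f j + ∑[ ℓ < M ] (𝟙 (V j ≟ˢ S ℓ) * g ℓ))  ≡⟨ ∑-distrib-+ f _ ⟩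
  ∑f + ∑[ j < n ] ∑[ ℓ < M ] (𝟙 (V j ≟ˢ S ℓ) * g ℓ)     ≡⟨ cong (∑f +_) by-class ⟩
  ∑f + ∑[ ℓ < M ] (c ℓ * g ℓ)                          ≤⟨ +-monoʳ-≤ ∑f (tail-bound c e mono) ⟩
  ∑f + M * ∑[ ℓ < M ] (c ℓ * e ℓ)                       ≤⟨ +-monoʳ-≤ ∑f (*-monoʳ-≤ M class-costs) ⟩
  (1 + M) * ∑f                                         ≡⟨ cong (_* ∑f) (m+[n∸m]≡n (m^n>0 2 k)) ⟩
  2 ^ k * ∑f                                           ≡⟨ cong (2 ^ k *_) (sym (sumFin≡sum f)) ⟩
  2 ^ k * cost A U V                                   ∎
  where
  open ≤-Reasoning
  M : ℕ
  M = 2 ^ k ∸ 1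
  err : Fin n → ℕ
  err j = minSubset (λ T → ∣ A j △ (⋃[ B ] T) ∣)
  f : Fin n → ℕ
  f j = ∣ A j △ (⋃[ U ] V j) ∣
  ∑f : ℕ
  ∑f = ∑[ j < n ] f j
  e : Fin M → ℕ
  e ℓ = ∣ (⋃[ U ] S ℓ) △ A (D (S ℓ)) ∣
  g : Fin M → ℕ
  g ℓ = ∑[ ℓ′ < M ] (𝟙 (ℓ FP.≤? ℓ′) * e ℓ′)
  c : Fin M → ℕ
  c ℓ = nCount V (S ℓ)

  covered : ∀ ℓ → ∣ (⋃[ U ] S ℓ) △ (⋃[ B ] S ℓ) ∣ ≤ g ℓ
  covered ℓ = union-bound (ℓ FP.≤?_) (λ ℓ′ → (⋃[ U ] S ℓ′) △ A (D (S ℓ′))) _ (cover ℓ)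

  column : ∀ j → err j ≤ f j + ∑[ ℓ < M ] (𝟙 (V j ≟ˢ S ℓ) * g ℓ)
  column j = ≤-trans (column-bound (A j) U B (V j))
    (+-monoʳ-≤ (f j) (class-term S onto (λ T → ∣ (⋃[ U ] T) △ (⋃[ B ] T) ∣) (⋃-⊥-agree U B) g covered (V j)))

  by-class : ∑[ j < n ] ∑[ ℓ < M ] (𝟙 (V j ≟ˢ S ℓ) * g ℓ) ≡ ∑[ ℓ < M ] (c ℓ * g ℓ)
  by-class = trans (∑-comm (λ j ℓ → 𝟙 (V j ≟ˢ S ℓ) * g ℓ)) (sum-cong-≗ (λ ℓ → count-weighted V (S ℓ) (g ℓ)))

  class-costs : ∑[ ℓ < M ] (c ℓ * e ℓ) ≤ ∑f
  class-costs = ≤-trans (sum-mono-≤ (λ ℓ → class-cost A U V (S ℓ) (D (S ℓ)) (nearest (S ℓ))))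
                        (classes-disjoint V inj f)
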